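{- A normal functor $F : \mathsf{CohI}^n \to \mathsf{CohI}$ is finite if and only if $\mathrm{NF}(F)$ is finite.
   Context: A coherence space is $X=(|X|,\frown\!\!\!\!\smile_X)$ with $|X|$ a set (the web) and $\frown\!\!\!\!\smile_X$ a reflexive symmetric relation on $|X|$. An embedding $X \hookrightarrow Y$ is an injection $\iota:|X|\to|Y|$ with $x \frown\!\!\!\!\smile_X x' \iff \iota(x) \frown\!\!\!\!\smile_Y \iota(x')$; $\mathsf{CohI}$ is the category of coherence spaces and embeddings. A functor is normal if it preserves filtered colimits and finite pullbacks; equivalently, for every $\vec X$ and $x\in|F(\vec X)|$ the slice of the category of elements $\mathsf{El}(|F|)/(\vec X,x)$ has a finite initial object. A normal form is an object of $\mathsf{El}(|F|)$ initial in its own slice; $\mathrm{NF}(F)$ is the set of isomorphism classes of normal forms, written $(X_1,\ldots,X_n \vdash x)$. The degree is $\deg(F)=\sup\{\mathrm{Card}(|X_i|) \mid (X_1,\ldots,X_n\vdash x)\in\mathrm{NF}(F),\ i\in\{1,\ldots,n\}\}$, and $F$ is finite if it preserves finiteness of cardinality and has finite degree. -}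

module Defs where

open import Level using (Level; 0ℓ)
open import Data.Nat using (ℕ; _≤_)
open import Data.Fin using (Fin)
open import Data.Product using (Σ; ∃; _×_; _,_; proj₁; proj₂)
open import Function.Bundles using (_↔_)
open import Relation.Binary.PropositionalEquality using (_≡_; refl; trans; cong)

record Coh : Set₁ where
  field
    web     : Set
    coh     : web → web → Set
    cohRefl : ∀ a → coh a a
    cohSym  : ∀ {a b} → coh a b → coh b a

open Coh public

-- Embeddings (morphisms of CohI): injections preserving and reflecting
-- coherence.

record Emb (X Y : Coh) : Set where
  field
    fun     : web X → web Y
    injective : ∀ {a b} → fun a ≡ fun b → a ≡ b
    cohPres : ∀ {a b} → coh X a b → coh Y (fun a) (fun b)
    cohRefl' : ∀ {a b} → coh Y (fun a) (fun b) → coh X a b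

open Emb public

idE : ∀ {X} → Emb X X
idE = record { fun = λ a → a ; injective = λ p → p ; cohPres = λ c → c ; cohRefl' = λ c → c }

_∘E_ : ∀ {X Y Z} → Emb Y Z → Emb X Y → Emb X Z
g ∘E f = record
  { fun = λ a → fun g (fun f a)
  ; injective = λ p → injective f (injective g p)
  ; cohPres = λ c → cohPres g (cohPres f c)
  ; cohRefl' = λ c → cohRefl' f (cohRefl' g c) }

_≈E_ : ∀ {X Y} → Emb X Y → Emb X Y → Set
f ≈E g = ∀ a → fun f a ≡ fun g a

Cohⁿ : ℕ → Set₁
Cohⁿ n = Fin n → Coh

Embⁿ : ∀ {n} → Cohⁿ n → Cohⁿ n → Set
Embⁿ X Y = ∀ i → Emb (X i) (Y i)

idⁿ : ∀ {n} {X : Cohⁿ n} → Embⁿ X X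
idⁿ i = idE

_∘ⁿ_ : ∀ {n} {X Y Z : Cohⁿ n} → Embⁿ Y Z → Embⁿ X Y → Embⁿ X Z
(g ∘ⁿ f) i = g i ∘E f i

_≈ⁿ_ : ∀ {n} {X Y : Cohⁿ n} → Embⁿ X Y → Embⁿ X Y → Set
f ≈ⁿ g = ∀ i → f i ≈E g i

record Functor (n : ℕ) : Set₁ where
  field
    F₀   : Cohⁿ n → Coh
    F₁   : ∀ {X Y} → Embⁿ X Y → Emb (F₀ X) (F₀ Y)
    F-id : ∀ {X} → F₁ (idⁿ {n} {X}) ≈E idE
    F-∘  : ∀ {X Y Z} (g : Embⁿ Y Z) (f : Embⁿ X Y) →
           F₁ (g ∘ⁿ f) ≈E (F₁ g ∘E F₁ f)
    F-cong : ∀ {X Y} {f g : Embⁿ X Y} → f ≈ⁿ g → F₁ f ≈E F₁ g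

open Functor public

module _ {n : ℕ} (F : Functor n) where

  record El : Set₁ where
    constructor el
    field
      ctx : Cohⁿ n
      pt  : web (F₀ F ctx)

  open El public

  ElHom : El → El → Set
  ElHom a b = Σ (Embⁿ (ctx a) (ctx b)) λ f → fun (F₁ F f) (pt a) ≡ pt b

  idEl : (a : El) → ElHom a a
  idEl a = idⁿ , F-id F (pt a)

  _∘El_ : ∀ {a b c} → ElHom b c → ElHom a b → ElHom a c
  _∘El_ {a} (g , p) (f , q) =
    (g ∘ⁿ f) , trans (F-∘ F g f (pt a)) (trans (cong (fun (F₁ F g)) q) p)

  _≈El_ : ∀ {a b} → ElHom a b → ElHom a b → Set
  f ≈El g = proj₁ f ≈ⁿ proj₁ g

  ElIso : El → El → Set
  ElIso a b = Σ (ElHom a b) λ f → Σ (ElHom b a) λ g →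
              ((g ∘El f) ≈El idEl a) × ((f ∘El g) ≈El idEl b)

  SliceOb : El → Set₁
  SliceOb e = Σ El λ a → ElHom a e

  SliceHom : ∀ {e} → SliceOb e → SliceOb e → Set
  SliceHom (a , f) (b , g) = Σ (ElHom a b) λ h → (g ∘El h) ≈El f

  IsInitial : ∀ {e} → SliceOb e → Set₁
  IsInitial {e} s = ∀ (t : SliceOb e) → Σ (SliceHom s t) λ h →
                    ∀ (h' : SliceHom s t) → proj₁ h ≈El proj₁ h'

FiniteSet : Set → Set
FiniteSet A = ∃ λ k → A ↔ Fin k

CardLeq : Set → ℕ → Set
CardLeq A d = ∃ λ k → k ≤ d × (A ↔ Fin k)

module _ {n : ℕ} (F : Functor n) where

  IsNormal : Set₁
  IsNormal = ∀ (e : El F) → Σ (SliceOb F e) λ s →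
             IsInitial F s × (∀ i → FiniteSet (web (ctx (proj₁ s) i)))

  IsNormalForm : El F → Set₁
  IsNormalForm a = IsInitial F {a} (a , idEl F a)

  NormalForm : Set₁
  NormalForm = Σ (El F) IsNormalForm

  -- NF(F) (normal forms up to isomorphism in El(|F|)) is finite:
  -- finitely many normal forms represent every isomorphism class.
  NFFinite : Set₁
  NFFinite = ∃ λ k → Σ (Fin k → NormalForm) λ nf →
             ∀ (a : NormalForm) → ∃ λ i → ElIso F (proj₁ a) (proj₁ (nf i))

  PreservesFiniteness : Set₁
  PreservesFiniteness = ∀ (X : Cohⁿ n) → (∀ i → FiniteSet (web (X i))) →
                        FiniteSet (web (F₀ F X))

  -- deg(F) finite: the sup of the Card(|X_i|) over normal forms is
  -- bounded by a natural number
  FiniteDegree : Set₁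
  FiniteDegree = ∃ λ d → ∀ (a : NormalForm) (i : Fin n) →
                 CardLeq (web (ctx (proj₁ a) i)) d

  IsFiniteFunctor : Set₁
  IsFiniteFunctor = PreservesFiniteness × FiniteDegree

-- Normal forms of a normal functor have finite webs, being isomorphic to the finite
-- initial object of their own slice. If NF(F) is finite, the degree is the largest of
-- finitely many such cardinalities, and every x ∈ F(X) is the image of a representative
-- normal form under one of the finitely many embeddings into X, so F preserves
-- finiteness. Conversely, if F is finite of degree d, every normal form is isomorphic to
-- one over a context of coherence spaces on Fin k, k ≤ d, coded by Boolean matrices;
-- there are finitely many such contexts, each with a finite F-image, and choosing a normal
-- form isomorphic to each of their elements, where one exists, gives a finite set of
-- representatives. Excluded middle makes these choices and equality of points decidable.
module Submission where

open import Level using (Level; lift; lower; 0ℓ)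
open import Data.Nat using (ℕ; zero; suc; s≤s)
open import Data.Fin using (Fin; zero; suc)
open import Data.Fin.Properties using (∀-cons)
open import Data.Bool using (Bool; true; false; T)
open import Data.Unit using (tt)
open import Data.Empty using (⊥-elim)
open import Data.Sum using (_⊎_; inj₁; inj₂)
open import Data.Product using (Σ; ∃; _,_; proj₁; proj₂)
open import Data.List
  using (List; []; _∷_; map; concatMap; length; lookup; allFin; upTo; deduplicate; cartesianProductWith)
open import Data.List.Extrema.Nat using (max; xs≤max)
open import Data.List.Relation.Unary.All as All using ()
open import Data.List.Relation.Unary.Any as Any using (Any; here; there; index)
open import Data.List.Relation.Unary.Any.Properties using (concatMap⁺; map⁺; lookup-index)
open import Data.List.Membership.Propositional using (_∈_; lose; find)
open import Data.List.Membership.Propositional.Properties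
  using (∈-allFin; ∈-map⁺; ∈-lookup; ∈-deduplicate⁺; ∈-upTo⁺; ∈-cartesianProductWith⁺)
open import Data.List.Membership.Propositional.Properties.WithK using (unique⇒irrelevant)
open import Data.List.Relation.Unary.Unique.Propositional using (Unique)
open import Data.List.Relation.Unary.Unique.DecPropositional.Properties using (deduplicate-!)
open import Function.Bundles using (_↔_; mk↔ₛ′; Inverse; Injection; _⇔_; mk⇔; Equivalence)
open import Function.Properties.Inverse using (↔-refl; ↔-sym; ↔-trans; ↔⇒↣)
open import Relation.Nullary using (Dec; yes; no)
open import Relation.Nullary.Decidable using (map′)
open import Relation.Binary.Definitions using (DecidableEquality)
open import Relation.Binary.PropositionalEquality
  using (_≡_; refl; sym; trans; cong; subst; subst₂; module ≡-Reasoning)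
open import Axiom.ExcludedMiddle using (ExcludedMiddle)
open import Defs

private
  variable
    a b r : Level
    A : Set a
    B : Set b

choices : {m : ℕ} {P : Fin m → Set a} → ((i : Fin m) → List (P i)) → List ((i : Fin m) → P i)
choices {m = zero}  xss = (λ ()) ∷ []
choices {m = suc m} xss = concatMap (λ x → map (∀-cons x) (choices (λ i → xss (suc i)))) (xss zero)

Any-choices⁺ : {m : ℕ} {P : Fin m → Set a} {Q : (i : Fin m) → P i → Set r}
               (xss : (i : Fin m) → List (P i)) →
               (∀ i → Any (Q i) (xss i)) → Any (λ f → ∀ i → Q i (f i)) (choices xss)
Any-choices⁺ {m = zero}  xss qs = here (λ ())
Any-choices⁺ {m = suc m} xss qs =
  concatMap⁺ _ (Any.map (λ q₀ → map⁺ (Any.map (λ qₛ → ∀-cons q₀ qₛ)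
                                            (Any-choices⁺ (λ i → xss (suc i)) (λ i → qs (suc i)))))
                      (qs zero))

representatives : (xs : List A) (R : A → B → Set r) → (∀ x → Dec (∃ (R x))) →
                  Σ (List B) λ ys → ∀ {x y} → x ∈ xs → R x y → Any (R x) ys
representatives {A = A} {B = B} xs R R? =
  concatMap (λ x → witness (R? x)) xs , λ x∈xs r → concatMap⁺ _ (lose x∈xs (chosen r))
  where
  witness : ∀ {x} → Dec (∃ (R x)) → List B
  witness (yes (y , _)) = y ∷ []
  witness (no _)        = []
  chosen : ∀ {x y} → R x y → Any (R x) (witness (R? x))
  chosen {x} r with R? x
  ... | yes (_ , r′) = here r′
  ... | no ¬r        = ⊥-elim (¬r (_ , r))

index-∈-lookup : (xs : List A) (i : Fin (length xs)) → index (∈-lookup {xs = xs} i) ≡ i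
index-∈-lookup (x ∷ xs) zero    = refl
index-∈-lookup (x ∷ xs) (suc i) = cong suc (index-∈-lookup xs i)

unique-enumeration↔Fin : (xs : List A) → Unique xs → (∀ x → x ∈ xs) → A ↔ Fin (length xs)
unique-enumeration↔Fin xs unique complete =
  mk↔ₛ′ (λ x → index (complete x)) (lookup xs) index∘lookup (λ x → sym (lookup-index (complete x)))
  where
  index∘lookup : ∀ i → index (complete (lookup xs i)) ≡ i
  index∘lookup i = trans (cong index (unique⇒irrelevant unique (complete _) (∈-lookup i)))
                         (index-∈-lookup xs i)

enumeration⇒finite : DecidableEquality A → (xs : List A) → (∀ x → x ∈ xs) → FiniteSet A
enumeration⇒finite _≟_ xs complete =
  _ , unique-enumeration↔Fin (deduplicate _≟_ xs) (deduplicate-! _≟_ xs)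
                             (λ x → ∈-deduplicate⁺ _≟_ (complete x))

finite⇒enumeration : FiniteSet A → ∃ λ xs → ∀ (x : A) → x ∈ xs
finite⇒enumeration (k , e) =
  map from (allFin k) , λ x → subst (_∈ _) (strictlyInverseʳ x) (∈-map⁺ from (∈-allFin (to x)))
  where open Inverse e

record _≅_ (X Y : Coh) : Set where
  field
    forth      : Emb X Y
    back       : Emb Y X
    back∘forth : ∀ x → fun back (fun forth x) ≡ x
    forth∘back : ∀ y → fun forth (fun back y) ≡ y

open _≅_

↔⇒≅ : {X Y : Coh} (e : web X ↔ web Y) →
      (∀ y y′ → coh X (Inverse.from e y) (Inverse.from e y′) ⇔ coh Y y y′) → X ≅ Y
↔⇒≅ {X} {Y} e coh⇔ = record
  { forth      = record
      { fun       = to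
      ; injective = Injection.injective (↔⇒↣ e)
      ; cohPres   = λ c → Equivalence.to (coh⇔ _ _)
                          (subst₂ (coh X) (sym (strictlyInverseʳ _)) (sym (strictlyInverseʳ _)) c)
      ; cohRefl'  = λ c → subst₂ (coh X) (strictlyInverseʳ _) (strictlyInverseʳ _)
                                 (Equivalence.from (coh⇔ _ _) c)
      }
  ; back       = record
      { fun       = from
      ; injective = Injection.injective (↔⇒↣ (↔-sym e))
      ; cohPres   = Equivalence.from (coh⇔ _ _)
      ; cohRefl'  = Equivalence.to (coh⇔ _ _)
      }
  ; back∘forth = strictlyInverseʳ
  ; forth∘back = strictlyInverseˡ
  }
  where open Inverse e

-- Coherence spaces on Fin k, coded by an arbitrary Boolean matrix that ⟦_⟧ᶜ closes
-- reflexively and symmetrically.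
FinCoh : Set
FinCoh = Σ ℕ λ k → Fin k → Fin k → Bool

⟦_⟧ᶜ : FinCoh → Coh
⟦ k , R ⟧ᶜ = record
  { web     = Fin k
  ; coh     = λ u v → u ≡ v ⊎ T (R u v) ⊎ T (R v u)
  ; cohRefl = λ _ → inj₁ refl
  ; cohSym  = λ { (inj₁ u≡v)      → inj₁ (sym u≡v)
                ; (inj₂ (inj₁ r)) → inj₂ (inj₂ r)
                ; (inj₂ (inj₂ r)) → inj₂ (inj₁ r) }
  }

≅⟦⟧ᶜ : {X : Coh} {k : ℕ} (e : web X ↔ Fin k) (R : Fin k → Fin k → Bool) →
       (∀ u v → T (R u v) ⇔ coh X (Inverse.from e u) (Inverse.from e v)) → X ≅ ⟦ k , R ⟧ᶜ
≅⟦⟧ᶜ {X} e R R⇔ = ↔⇒≅ e λ u v → mk⇔ (λ c → inj₂ (inj₁ (Equivalence.from (R⇔ u v) c))) λ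
  { (inj₁ refl)     → cohRefl X _
  ; (inj₂ (inj₁ r)) → Equivalence.to (R⇔ u v) r
  ; (inj₂ (inj₂ r)) → cohSym X (Equivalence.to (R⇔ v u) r)
  }

finCohsOfSize : ℕ → List FinCoh
finCohsOfSize k = map (k ,_) (choices λ _ → choices λ _ → true ∷ false ∷ [])

finCohs : ℕ → List FinCoh
finCohs d = concatMap finCohsOfSize (upTo (suc d))

module _ (em : ExcludedMiddle (Level.suc 0ℓ)) where

  decide : (P : Set) → Dec P
  decide P = map′ lower lift em

  reflecting-bool : (P : Set) → Any (λ b → T b ⇔ P) (true ∷ false ∷ [])
  reflecting-bool P with decide P
  ... | yes p = here (mk⇔ (λ _ → p) (λ _ → tt))
  ... | no ¬p = there (here (mk⇔ (λ ()) ¬p))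

  finCohs-complete : (d : ℕ) (X : Coh) → CardLeq (web X) d → Any (λ c → X ≅ ⟦ c ⟧ᶜ) (finCohs d)
  finCohs-complete d X (k , k≤d , e) =
    concatMap⁺ finCohsOfSize (lose (∈-upTo⁺ (s≤s k≤d)) (map⁺ (Any.map (≅⟦⟧ᶜ e _)
      (Any-choices⁺ _ λ u → Any-choices⁺ _ λ v → reflecting-bool (coh X (from u) (from v))))))
    where open Inverse e

  embeddings : {X Y : Coh} → FiniteSet (web X) → FiniteSet (web Y) →
               Σ (List (Emb X Y)) λ fs → ∀ f → Any (f ≈E_) fs
  embeddings {X} {Y} (k , eX) (l , eY) = proj₁ tabled , complete
    where
    module X = Inverse eX
    module Y = Inverse eY
    table : Emb X Y → Fin k → Fin l
    table f u = Y.to (fun f (X.from u))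
    HasTable : (Fin k → Fin l) → Emb X Y → Set
    HasTable t f = ∀ u → table f u ≡ t u
    -- not every table is that of an embedding, so one is chosen for each table that is
    tabled : Σ (List (Emb X Y)) λ fs →
             ∀ {t f} → t ∈ choices (λ _ → allFin l) → HasTable t f → Any (HasTable t) fs
    tabled = representatives (choices (λ _ → allFin l)) HasTable (λ t → decide _)
    same-table⇒≈E : ∀ {t} f f′ → HasTable t f → HasTable t f′ → f ≈E f′
    same-table⇒≈E f f′ f↦t f′↦t x = Injection.injective (↔⇒↣ eY) (begin
      Y.to (fun f x)     ≡⟨ cong (λ y → Y.to (fun f y)) (sym (X.strictlyInverseʳ x)) ⟩
      table f (X.to x)   ≡⟨ trans (f↦t _) (sym (f′↦t _)) ⟩
      table f′ (X.to x)  ≡⟨ cong (λ y → Y.to (fun f′ y)) (X.strictlyInverseʳ x) ⟩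
      Y.to (fun f′ x)    ∎)
      where open ≡-Reasoning
    complete : ∀ f → Any (f ≈E_) (proj₁ tabled)
    complete f =
      let (t , t∈ , f↦t) = find (Any-choices⁺ _ λ u → ∈-allFin (table f u))
      in Any.map (λ {f′} → same-table⇒≈E f f′ f↦t) (proj₂ tabled {t} {f} t∈ f↦t)

  embeddingsⁿ : {n : ℕ} {X Y : Cohⁿ n} →
                (∀ i → FiniteSet (web (X i))) → (∀ i → FiniteSet (web (Y i))) →
                Σ (List (Embⁿ X Y)) λ φs → ∀ φ → Any (φ ≈ⁿ_) φs
  embeddingsⁿ finX finY =
    choices (λ i → proj₁ (embeddings (finX i) (finY i))) ,
    λ φ → Any-choices⁺ _ λ i → proj₂ (embeddings (finX i) (finY i)) (φ i)

module _ {n : ℕ} (F : Functor n) where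

  ElIso-sym : {a b : El F} → ElIso F a b → ElIso F b a
  ElIso-sym (f , g , g∘f , f∘g) = g , f , f∘g , g∘f

  ElIso-trans : {a b c : El F} → ElIso F a b → ElIso F b c → ElIso F a c
  ElIso-trans (f , g , g∘f , f∘g) (f′ , g′ , g′∘f′ , f′∘g′) =
    _∘El_ F f′ f , _∘El_ F g g′ ,
    (λ i x → trans (cong (fun (proj₁ g i)) (g′∘f′ i (fun (proj₁ f i) x))) (g∘f i x)) ,
    (λ i x → trans (cong (fun (proj₁ f′ i)) (f∘g i (fun (proj₁ g′ i) x))) (f′∘g′ i x))

  ElIso⇒↔ : {a b : El F} → ElIso F a b → ∀ i → web (ctx a i) ↔ web (ctx b i)
  ElIso⇒↔ ((f , _) , (g , _) , g∘f , f∘g) i = mk↔ₛ′ (fun (f i)) (fun (g i)) (f∘g i) (g∘f i)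

  ≅ⁿ⇒ElIso : {X Y : Cohⁿ n} (φ : ∀ i → X i ≅ Y i) (x : web (F₀ F X)) →
             ElIso F (el X x) (el Y (fun (F₁ F (λ i → forth (φ i))) x))
  ≅ⁿ⇒ElIso {X} {Y} φ x =
    (forthⁿ , refl) , (backⁿ , back-pt) , (λ i → back∘forth (φ i)) , (λ i → forth∘back (φ i))
    where
    forthⁿ : Embⁿ X Y
    forthⁿ i = forth (φ i)
    backⁿ : Embⁿ Y X
    backⁿ i = back (φ i)
    back-pt : fun (F₁ F backⁿ) (fun (F₁ F forthⁿ) x) ≡ x
    back-pt = trans (sym (F-∘ F backⁿ forthⁿ x))
                    (trans (F-cong F (λ i → back∘forth (φ i)) x) (F-id F x))

  initial-endo≈id : {e : El F} (s : SliceOb F e) → IsInitial F s →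
                    (h : SliceHom F s s) → _≈El_ F (proj₁ h) (idEl F (proj₁ s))
  initial-endo≈id s initial h i x =
    trans (sym (proj₂ (initial s) h i x)) (proj₂ (initial s) (idEl F (proj₁ s) , λ _ _ → refl) i x)

  initial⇒normalForm : {e : El F} (s : SliceOb F e) → IsInitial F s → IsNormalForm F (proj₁ s)
  initial⇒normalForm {e} (a , h) initial (b , g) =
    (m , g∘m≈id) ,
    λ (m′ , g∘m′≈id) → proj₂ (initial (b , _∘El_ F h g))
                             (m′ , λ i x → cong (fun (proj₁ h i)) (g∘m′≈id i x))
    where
    m⁺ : SliceHom F (a , h) (b , _∘El_ F h g)
    m⁺ = proj₁ (initial (b , _∘El_ F h g))
    m : ElHom F a b
    m = proj₁ m⁺
    g∘m≈id : _≈El_ F (_∘El_ F g m) (idEl F a)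
    g∘m≈id = initial-endo≈id {e} (a , h) initial (_∘El_ F g m , proj₂ m⁺)

  normalForm≅initial : {a : El F} → IsNormalForm F a →
                       (s : SliceOb F a) → IsInitial F s → ElIso F a (proj₁ s)
  normalForm≅initial {a} isNF (s , h) initial = m , h , h∘m≈id , m∘h≈id
    where
    m⁺ : SliceHom F (a , idEl F a) (s , h)
    m⁺ = proj₁ (isNF (s , h))
    m : ElHom F a s
    m = proj₁ m⁺
    h∘m≈id : _≈El_ F (_∘El_ F h m) (idEl F a)
    h∘m≈id = proj₂ m⁺
    m∘h≈id : _≈El_ F (_∘El_ F m h) (idEl F s)
    m∘h≈id = initial-endo≈id {a} (s , h) initial
               (_∘El_ F m h , λ i x → h∘m≈id i (fun (proj₁ h i) x))

  normalForm-finite : IsNormal F → (a : NormalForm F) → ∀ i → FiniteSet (web (ctx (proj₁ a) i))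
  normalForm-finite normal (a , isNF) i =
    let (s , initial , finite) = normal a
        (k , e) = finite i
    in k , ↔-trans (ElIso⇒↔ (normalForm≅initial isNF s initial) i) e

  module _ (normal : IsNormal F) {K : ℕ} (nf : Fin K → NormalForm F)
           (classify : ∀ (a : NormalForm F) → ∃ λ j → ElIso F (proj₁ a) (proj₁ (nf j))) where

    nf-finite : (j : Fin K) (i : Fin n) → FiniteSet (web (ctx (proj₁ (nf j)) i))
    nf-finite j = normalForm-finite normal (nf j)

    finiteDegree : FiniteDegree F
    finiteDegree = max 0 cards , bounded
      where
      card : Fin K → Fin n → ℕ
      card j i = proj₁ (nf-finite j i)
      cards : List ℕ
      cards = cartesianProductWith card (allFin K) (allFin n)
      bounded : ∀ a i → CardLeq (web (ctx (proj₁ a) i)) (max 0 cards)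
      bounded a i =
        let (j , a≅nf) = classify a
        in card j i ,
           All.lookup (xs≤max 0 cards) (∈-cartesianProductWith⁺ card (∈-allFin j) (∈-allFin i)) ,
           ↔-trans (ElIso⇒↔ a≅nf i) (proj₂ (nf-finite j i))

    factors-through-nf : (X : Cohⁿ n) (x : web (F₀ F X)) → ∃ λ j → ElHom F (proj₁ (nf j)) (el X x)
    factors-through-nf X x =
      let ((s , h) , initial , _) = normal (el X x)
          (j , s≅nf) = classify (s , initial⇒normalForm (s , h) initial)
      in j , _∘El_ F h (proj₁ (proj₂ s≅nf))

    preservesFiniteness : ExcludedMiddle (Level.suc 0ℓ) → PreservesFiniteness F
    preservesFiniteness em X finX =
      enumeration⇒finite (λ x y → decide em (x ≡ y)) (concatMap images (allFin K)) complete
      where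
      images : Fin K → List (web (F₀ F X))
      images j = map (λ φ → fun (F₁ F φ) (pt (proj₁ (nf j))))
                     (proj₁ (embeddingsⁿ em (nf-finite j) finX))
      complete : ∀ x → x ∈ concatMap images (allFin K)
      complete x =
        let (j , φ , φ↦x) = factors-through-nf X x
        in concatMap⁺ images (lose (∈-allFin j) (map⁺
             (Any.map (λ φ≈φ′ → trans (sym φ↦x) (F-cong F φ≈φ′ _))
                      (proj₂ (embeddingsⁿ em (nf-finite j) finX) φ))))

  finite⇒NFFinite : ExcludedMiddle (Level.suc 0ℓ) → IsFiniteFunctor F → NFFinite F
  finite⇒NFFinite em (preserves , d , bounded) = length nfs , lookup nfs , classify
    where
    Coded : Set
    Coded = Σ (Fin n → FinCoh) λ c → web (F₀ F (λ i → ⟦ c i ⟧ᶜ))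
    enumerateOver : (c : Fin n → FinCoh) → ∃ λ xs → ∀ (x : web (F₀ F (λ i → ⟦ c i ⟧ᶜ))) → x ∈ xs
    enumerateOver c = finite⇒enumeration (preserves _ (λ i → _ , ↔-refl))
    elementsOver : (c : Fin n → FinCoh) → List Coded
    elementsOver c = map (c ,_) (proj₁ (enumerateOver c))
    coded : List Coded
    coded = concatMap elementsOver (choices λ _ → finCohs d)
    Represents : Coded → NormalForm F → Set
    Represents (c , x) a = ElIso F (proj₁ a) (el _ x)
    represented : Σ (List (NormalForm F)) λ as →
                  ∀ {cx a} → cx ∈ coded → Represents cx a → Any (Represents cx) as
    represented = representatives coded Represents (λ _ → em)
    nfs : List (NormalForm F)
    nfs = proj₁ represented
    isCoded : (a : NormalForm F) → Any (λ cx → Represents cx a) coded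
    isCoded (a , isNF) =
      concatMap⁺ elementsOver
        (Any.map (λ {c} φ → map⁺ (lose (proj₂ (enumerateOver c) _) (≅ⁿ⇒ElIso φ (pt a))))
                 (Any-choices⁺ _ λ i → finCohs-complete em d (ctx a i) (bounded (a , isNF) i)))
    classify : ∀ a → ∃ λ i → ElIso F (proj₁ a) (proj₁ (lookup nfs i))
    classify a =
      let (cx , cx∈ , a~cx) = find (isCoded a)
          p = proj₂ represented {a = a} cx∈ a~cx
      in index p , ElIso-trans a~cx (ElIso-sym (lookup-index p))

proposition23 : ExcludedMiddle (Level.suc 0ℓ) → {n : ℕ} (F : Functor n) →
    IsNormal F → (IsFiniteFunctor F ⇔ NFFinite F)
proposition23 em F normal = mk⇔ (finite⇒NFFinite F em) λ (_ , nf , classify) →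
  preservesFiniteness F normal nf classify em , finiteDegree F normal nf classify
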